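{- Let $n\ge 1$ and $N=\binom{n}{2}+m$ with $1\le m\le \frac{n-1}{2}$. Then $C(N)=(n-1)\binom{n}{2}+m(4m-n+1)$.
   Context: All graphs are finite and simple. For a graph $G$, $S(G)=\sum_{uv\in E(G)}\min(\deg u,\deg v)$. A vertex is universal if it is adjacent to every other vertex. For an integer $N\ge1$ written uniquely as $N=\binom{n}{2}+m$ with $n\ge 1$, $1\le m\le n$, $C(N)$ denotes the maximum of $S(G)$ over all graphs $G$ with exactly $N$ edges, exactly $n+1$ vertices and no universal vertex. -}

module Defs where

open import Data.Nat using (ℕ; _+_; _⊓_; _≤_)
open import Data.Bool using (Bool; true; false; if_then_else_)
open import Data.Fin using (Fin; _<?_)
open import Data.List using (List; map; allFin)
open import Data.Nat.ListAction using (sum)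
open import Data.Product using (_×_; Σ)
open import Relation.Nullary using (¬_; does)
open import Relation.Binary.PropositionalEquality using (_≡_; _≢_)

record Graph (V : ℕ) : Set where
  field
    adj    : Fin V → Fin V → Bool
    sym    : ∀ u v → adj u v ≡ adj v u
    irrefl : ∀ v → adj v v ≡ false
open Graph public

ΣV : (V : ℕ) → (Fin V → ℕ) → ℕ
ΣV V f = sum (map f (allFin V))

deg : ∀ {V} → Graph V → Fin V → ℕ
deg {V} G v = ΣV V (λ w → if adj G v w then 1 else 0)

ΣE : ∀ {V} → Graph V → (Fin V → Fin V → ℕ) → ℕ
ΣE {V} G f = ΣV V (λ u → ΣV V (λ v →
  if does (u <? v) then (if adj G u v then f u v else 0) else 0))

edges : ∀ {V} → Graph V → ℕ
edges G = ΣE G (λ _ _ → 1)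

S : ∀ {V} → Graph V → ℕ
S G = ΣE G (λ u v → deg G u ⊓ deg G v)

Universal : ∀ {V} → Graph V → Fin V → Set
Universal G v = ∀ w → w ≢ v → adj G v w ≡ true

IsMaxS : ℕ → ℕ → ℕ → Set
IsMaxS N V c =
  (Σ (Graph V) λ G → (edges G ≡ N) × (∀ v → ¬ Universal G v) × (S G ≡ c))
  × (∀ (G : Graph V) → edges G ≡ N → (∀ v → ¬ Universal G v) → S G ≤ c)

-- A graph on n + 1 vertices without universal vertex has all degrees at most n − 1.
-- Let w u = (n − 1) − deg u and W = Σ w u; the edge count N = C(n,2) + m forces
-- W = n − 1 − 2m. On every edge min(deg u, deg v) + max(w u, w v) = n − 1, hence
-- 2 S(G) = (n − 1) · 2N − Σ max(w u, w v), summed over ordered adjacent pairs.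
-- As max(a, b) ≥ a + b − ab, that sum is at least 2 Σ w u deg u − Σ w u w v, and
-- Σ w u deg u = W (n − 1) − Σ w u², Σ w u w v + Σ w u² ≤ W², Σ w u² ≤ W² give the
-- lower bound 2W (n − 1 − W) = 4mW. Equality holds for K_n minus m disjoint edges
-- plus a vertex joined to their 2m endpoints: only that vertex has positive w.

module Submission where

open import Defs renaming (sym to adj-sym)
open import Data.Bool using (Bool; true; false; if_then_else_; not; _∨_; _∧_)
open import Data.Bool.Properties using (T-≡; ⇔→≡; ∨-zeroʳ)
open import Data.Empty using (⊥-elim)
open import Data.Fin as Fin using (Fin; zero; suc; toℕ; punchIn; punchOut)
import Data.Fin.Properties as Finₚ
open import Data.List using (tabulate; _∷_; [])
open import Data.List.Properties using (map-tabulate)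
import Data.Nat.ListAction as List
open import Data.Nat
open import Data.Nat.Properties
open import Data.Nat.Combinatorics using (_C_; nC1≡n; nCk+nC[k+1]≡[n+1]C[k+1])
open import Data.Nat.Tactic.RingSolver using (solve)
open import Data.Product using (Σ; _×_; _,_; proj₂)
open import Data.Sum using (inj₁; inj₂)
open import Data.Vec.Functional using (removeAt)
open import Function using (_∘_; Equivalence; mk⇔)
open import Relation.Nullary using (¬_; does; proof)
open import Relation.Nullary.Reflects using (ofʸ; ofⁿ)
open import Relation.Nullary.Decidable using (dec-true; dec-false)
open import Relation.Binary.Definitions using (tri<; tri≈; tri>)
open import Relation.Binary.PropositionalEquality
open import Algebra.Properties.Semiring.Sum +-*-semiring
  using (sum; sum-cong-≗; sum-remove; sum-replicate-zero; ∑-distrib-+; ∑-comm; *-distribˡ-sum)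

ΣV≡sum : ∀ V (f : Fin V → ℕ) → ΣV V f ≡ sum f
ΣV≡sum V f = trans (cong List.sum (map-tabulate (λ i → i) f)) (sum-tabulate V f)
  where
  sum-tabulate : ∀ V (f : Fin V → ℕ) → List.sum (tabulate f) ≡ sum f
  sum-tabulate zero    f = refl
  sum-tabulate (suc V) f = cong (f zero +_) (sum-tabulate V (f ∘ suc))

sum-mono-≤ : ∀ {n} {f g : Fin n → ℕ} → (∀ i → f i ≤ g i) → sum f ≤ sum g
sum-mono-≤ {zero}  f≤g = ≤-refl
sum-mono-≤ {suc n} f≤g = +-mono-≤ (f≤g zero) (sum-mono-≤ (f≤g ∘ suc))

sum-const : ∀ n c → sum {n} (λ _ → c) ≡ n * c
sum-const zero    c = refl
sum-const (suc n) c = cong (c +_) (sum-const n c)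

sum-*ˡ : ∀ {n} c (f : Fin n → ℕ) → sum (λ i → c * f i) ≡ c * sum f
sum-*ˡ c f = sym (*-distribˡ-sum c f)

sum-removeAt : ∀ {n} (f : Fin (suc n) → ℕ) {u} → f u ≡ 0 → sum f ≡ sum (removeAt f u)
sum-removeAt f {u} fu≡0 = trans (sum-remove {i = u} f) (cong (_+ sum (removeAt f u)) fu≡0)

⟦_⟧ : Bool → ℕ
⟦ b ⟧ = if b then 1 else 0

count : ∀ {n} → (Fin n → Bool) → ℕ
count b = sum (λ i → ⟦ b i ⟧)

count≤n : ∀ {n} (b : Fin n → Bool) → count b ≤ n
count≤n {zero}  b = z≤n
count≤n {suc n} b with b zero
... | true  = s≤s (count≤n (b ∘ suc))
... | false = m≤n⇒m≤1+n (count≤n (b ∘ suc))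

count≡n⇒true : ∀ {n} (b : Fin n → Bool) → count b ≡ n → ∀ i → b i ≡ true
count≡n⇒true {suc n} b eq i with b zero in b₀
count≡n⇒true {suc n} b eq zero    | true  = b₀
count≡n⇒true {suc n} b eq (suc i) | true  = count≡n⇒true (b ∘ suc) (suc-injective eq) i
... | false = ⊥-elim (1+n≰n (subst (_≤ n) eq (count≤n (b ∘ suc))))

≡ᵇ-refl : ∀ a → (a ≡ᵇ a) ≡ true
≡ᵇ-refl a = Equivalence.to T-≡ (≡⇒≡ᵇ a a refl)

≡ᵇ-sym : ∀ a b → (a ≡ᵇ b) ≡ (b ≡ᵇ a)
≡ᵇ-sym zero    zero    = refl
≡ᵇ-sym zero    (suc b) = refl
≡ᵇ-sym (suc a) zero    = refl
≡ᵇ-sym (suc a) (suc b) = ≡ᵇ-sym a b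

count-<ᵇ : ∀ {n t} → t ≤ n → count (λ (j : Fin n) → toℕ j <ᵇ t) ≡ t
count-<ᵇ {n}     {zero}  _         = sum-replicate-zero n
count-<ᵇ {suc n} {suc t} (s≤s t≤n) = cong suc (count-<ᵇ t≤n)

count-≡ᵇ : ∀ {n a} → a < n → count (λ (j : Fin n) → a ≡ᵇ toℕ j) ≡ 1
count-≡ᵇ {suc n} {zero}  _         = cong suc (sum-replicate-zero n)
count-≡ᵇ {suc n} {suc a} (s≤s a<n) = count-≡ᵇ a<n

count-∨ : ∀ {n} (b c : Fin n → Bool) → (∀ i → b i ≡ true → c i ≢ true) →
  count (λ i → b i ∨ c i) ≡ count b + count c
count-∨ b c disjoint = trans (sum-cong-≗ λ i → ⟦∨⟧ (b i) (c i) (disjoint i))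
  (∑-distrib-+ (λ i → ⟦ b i ⟧) (λ i → ⟦ c i ⟧))
  where
  ⟦∨⟧ : ∀ x y → (x ≡ true → y ≢ true) → ⟦ x ∨ y ⟧ ≡ ⟦ x ⟧ + ⟦ y ⟧
  ⟦∨⟧ true  true  both = ⊥-elim (both refl refl)
  ⟦∨⟧ true  false _    = refl
  ⟦∨⟧ false y     _    = refl

count-not : ∀ {n} (b : Fin n → Bool) → count (not ∘ b) + count b ≡ n
count-not {n} b = begin
  count (not ∘ b) + count b        ≡⟨ ∑-distrib-+ (λ i → ⟦ not (b i) ⟧) (λ i → ⟦ b i ⟧) ⟨
  sum (λ i → ⟦ not (b i) ⟧ + ⟦ b i ⟧) ≡⟨ sum-cong-≗ (λ i → ⟦not⟧ (b i)) ⟩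
  sum {n} (λ _ → 1)                ≡⟨ sum-const n 1 ⟩
  n * 1                            ≡⟨ *-identityʳ n ⟩
  n                                ∎
  where
  open ≡-Reasoning
  ⟦not⟧ : ∀ x → ⟦ not x ⟧ + ⟦ x ⟧ ≡ 1
  ⟦not⟧ true  = refl
  ⟦not⟧ false = refl

sum-hole : ∀ {n} {f g : Fin n → ℕ} u → (∀ i → f i ≤ g i) → f u ≡ 0 → sum f + g u ≤ sum g
sum-hole {suc n} {f} {g} u f≤g fu≡0 = begin
  sum f + g u                   ≡⟨ cong (_+ g u) (sum-removeAt f fu≡0) ⟩
  sum (removeAt f u) + g u      ≤⟨ +-monoˡ-≤ (g u) (sum-mono-≤ (f≤g ∘ punchIn u)) ⟩
  sum (removeAt g u) + g u      ≡⟨ +-comm _ (g u) ⟩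
  g u + sum (removeAt g u)      ≡⟨ sum-remove g ⟨
  sum g                         ∎
  where open ≤-Reasoning

term≤sum : ∀ {n} (f : Fin n → ℕ) u → f u ≤ sum f
term≤sum {suc n} f u = ≤-trans (m≤m+n (f u) _) (≤-reflexive (sym (sum-remove f)))

if-then-0 : ∀ b x → (if b then x else 0) ≡ x * ⟦ b ⟧
if-then-0 true  x = sym (*-identityʳ x)
if-then-0 false x = sym (*-zeroʳ x)

m*⟦b⟧≤m : ∀ m b → m * ⟦ b ⟧ ≤ m
m*⟦b⟧≤m m true  = ≤-reflexive (*-identityʳ m)
m*⟦b⟧≤m m false = ≤-trans (≤-reflexive (*-zeroʳ m)) z≤n

module _ {V : ℕ} (G : Graph V) where

  deg≡count : ∀ u → deg G u ≡ count (adj G u)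
  deg≡count u = ΣV≡sum V (λ v → ⟦ adj G u v ⟧)

  arcSum : (Fin V → Fin V → ℕ) → ℕ
  arcSum F = sum λ u → sum λ v → F u v * ⟦ adj G u v ⟧

  arcSum-cong : ∀ {F H : Fin V → Fin V → ℕ} →
    (∀ u v → adj G u v ≡ true → F u v ≡ H u v) → arcSum F ≡ arcSum H
  arcSum-cong {F} {H} F≡H = sum-cong-≗ {V} λ u → sum-cong-≗ {V} λ v → on-arc u v (adj G u v) refl
    where
    on-arc : ∀ u v b → adj G u v ≡ b → F u v * ⟦ b ⟧ ≡ H u v * ⟦ b ⟧
    on-arc u v true  uv = cong (_* 1) (F≡H u v uv)
    on-arc u v false _  = trans (*-zeroʳ (F u v)) (sym (*-zeroʳ (H u v)))

  arcSum-mono-≤ : ∀ {F H : Fin V → Fin V → ℕ} → (∀ u v → F u v ≤ H u v) → arcSum F ≤ arcSum H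
  arcSum-mono-≤ F≤H = sum-mono-≤ λ u → sum-mono-≤ λ v → *-monoˡ-≤ _ (F≤H u v)

  arcSum-+ : ∀ (F H : Fin V → Fin V → ℕ) →
    arcSum (λ u v → F u v + H u v) ≡ arcSum F + arcSum H
  arcSum-+ F H = begin
    arcSum (λ u v → F u v + H u v)
      ≡⟨ sum-cong-≗ {V} (λ u → sum-cong-≗ {V} λ v → *-distribʳ-+ ⟦ adj G u v ⟧ (F u v) (H u v)) ⟩
    sum (λ u → sum λ v → F u v * ⟦ adj G u v ⟧ + H u v * ⟦ adj G u v ⟧)
      ≡⟨ sum-cong-≗ {V} (λ u → ∑-distrib-+ {V} _ _) ⟩
    sum (λ u → sum (λ v → F u v * ⟦ adj G u v ⟧) + sum λ v → H u v * ⟦ adj G u v ⟧)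
      ≡⟨ ∑-distrib-+ {V} _ _ ⟩
    arcSum F + arcSum H ∎
    where open ≡-Reasoning

  arcSum-transpose : ∀ (F : Fin V → Fin V → ℕ) → arcSum (λ u v → F v u) ≡ arcSum F
  arcSum-transpose F = trans (∑-comm (λ u v → F v u * ⟦ adj G u v ⟧))
    (sum-cong-≗ {V} λ v → sum-cong-≗ {V} λ u → cong (λ b → F v u * ⟦ b ⟧) (adj-sym G u v))

  arcSum-row : ∀ (a : Fin V → ℕ) → arcSum (λ u v → a u) ≡ sum (λ u → a u * deg G u)
  arcSum-row a = sum-cong-≗ {V} λ u →
    trans (sum-*ˡ (a u) (λ v → ⟦ adj G u v ⟧)) (cong (a u *_) (sym (deg≡count u)))

  arcSum-endpoints : ∀ (a : Fin V → ℕ) →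
    arcSum (λ u v → a u + a v) ≡ 2 * sum (λ u → a u * deg G u)
  arcSum-endpoints a = begin
    arcSum (λ u v → a u + a v)
      ≡⟨ arcSum-+ (λ u v → a u) (λ u v → a v) ⟩
    arcSum (λ u v → a u) + arcSum (λ u v → a v)
      ≡⟨ cong (arcSum (λ u v → a u) +_) (arcSum-transpose (λ u v → a u)) ⟩
    arcSum (λ u v → a u) + arcSum (λ u v → a u)
      ≡⟨ cong (λ x → x + x) (arcSum-row a) ⟩
    P + P
      ≡⟨ cong (P +_) (+-identityʳ P) ⟨
    2 * P ∎
    where
    open ≡-Reasoning
    P : ℕ
    P = sum (λ u → a u * deg G u)

  arcSum-product : ∀ (a : Fin V → ℕ) →
    arcSum (λ u v → a u * a v) + sum (λ u → a u * a u) ≤ sum a * sum a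
  arcSum-product a = begin
    arcSum (λ u v → a u * a v) + sum (λ u → a u * a u)
      ≡⟨ cong (_+ sum (λ u → a u * a u)) (sum-cong-≗ {V} λ u →
           trans (sum-cong-≗ {V} λ v → *-assoc (a u) (a v) _) (sum-*ˡ (a u) (λ v → a v * ⟦ adj G u v ⟧))) ⟩
    sum (λ u → a u * neighbours u) + sum (λ u → a u * a u)
      ≡⟨ ∑-distrib-+ {V} _ _ ⟨
    sum (λ u → a u * neighbours u + a u * a u)
      ≡⟨ sum-cong-≗ {V} (λ u → *-distribˡ-+ (a u) (neighbours u) (a u)) ⟨
    sum (λ u → a u * (neighbours u + a u))
      ≤⟨ sum-mono-≤ (λ u → *-monoʳ-≤ (a u)
           (sum-hole u (λ v → m*⟦b⟧≤m (a v) (adj G u v)) (neighbours-hole u))) ⟩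
    sum (λ u → a u * sum a)
      ≡⟨ sum-cong-≗ {V} (λ u → *-comm (a u) (sum a)) ⟩
    sum (λ u → sum a * a u)
      ≡⟨ sum-*ˡ (sum a) a ⟩
    sum a * sum a ∎
    where
    open ≤-Reasoning
    neighbours : Fin V → ℕ
    neighbours u = sum λ v → a v * ⟦ adj G u v ⟧
    neighbours-hole : ∀ u → a u * ⟦ adj G u u ⟧ ≡ 0
    neighbours-hole u = trans (cong (λ b → a u * ⟦ b ⟧) (irrefl G u)) (*-zeroʳ (a u))

  2*ΣE≡arcSum : ∀ (f : Fin V → Fin V → ℕ) → (∀ u v → f u v ≡ f v u) → 2 * ΣE G f ≡ arcSum f
  2*ΣE≡arcSum f f-sym = begin
    2 * ΣE G f                 ≡⟨ cong (2 *_) (trans (ΣV≡sum V _) (sum-cong-≗ {V} λ u → ΣV≡sum V _)) ⟩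
    2 * X                      ≡⟨ cong (X +_) (+-identityʳ X) ⟩
    X + X                      ≡⟨ cong (X +_) (∑-comm forward) ⟩
    X + sum (λ u → sum λ v → forward v u) ≡⟨ ∑-distrib-+ {V} _ _ ⟨
    sum (λ u → sum (λ v → forward u v) + sum λ v → forward v u)
                               ≡⟨ sum-cong-≗ {V} (λ u → ∑-distrib-+ {V} _ _) ⟨
    sum (λ u → sum λ v → forward u v + forward v u)
                               ≡⟨ sum-cong-≗ {V} (λ u → sum-cong-≗ {V} λ v → arc-split u v) ⟨
    arcSum f                   ∎
    where
    open ≡-Reasoning
    forward : Fin V → Fin V → ℕ
    forward u v = if does (u Fin.<? v) then (if adj G u v then f u v else 0) else 0
    X : ℕ
    X = sum λ u → sum λ v → forward u v
    forward-< : ∀ {u v} → u Fin.< v → forward u v ≡ f u v * ⟦ adj G u v ⟧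
    forward-< {u} {v} u<v = trans
      (cong (λ b → if b then (if adj G u v then f u v else 0) else 0) (dec-true (u Fin.<? v) u<v))
      (if-then-0 (adj G u v) (f u v))
    forward-≮ : ∀ {u v} → ¬ u Fin.< v → forward u v ≡ 0
    forward-≮ {u} {v} u≮v =
      cong (λ b → if b then (if adj G u v then f u v else 0) else 0) (dec-false (u Fin.<? v) u≮v)
    arc-split : ∀ u v → f u v * ⟦ adj G u v ⟧ ≡ forward u v + forward v u
    arc-split u v with Finₚ.<-cmp u v
    ... | tri< u<v _ v≮u = sym (trans (cong₂ _+_ (forward-< u<v) (forward-≮ v≮u)) (+-identityʳ _))
    ... | tri> u≮v _ v<u = begin
      f u v * ⟦ adj G u v ⟧   ≡⟨ cong₂ (λ x b → x * ⟦ b ⟧) (f-sym u v) (adj-sym G u v) ⟩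
      f v u * ⟦ adj G v u ⟧   ≡⟨ cong₂ _+_ (forward-≮ u≮v) (forward-< v<u) ⟨
      forward u v + forward v u ∎
    ... | tri≈ u≮v refl _ = begin
      f u u * ⟦ adj G u u ⟧   ≡⟨ cong (λ b → f u u * ⟦ b ⟧) (irrefl G u) ⟩
      f u u * 0               ≡⟨ *-zeroʳ (f u u) ⟩
      0                       ≡⟨ cong₂ _+_ (forward-≮ u≮v) (forward-≮ u≮v) ⟨
      forward u u + forward u u ∎

  handshake : sum (deg G) ≡ 2 * edges G
  handshake = begin
    sum (deg G)                     ≡⟨ sum-cong-≗ {V} (λ u → *-identityˡ (deg G u)) ⟨
    sum (λ u → 1 * deg G u)         ≡⟨ arcSum-row (λ _ → 1) ⟨
    arcSum (λ _ _ → 1)              ≡⟨ 2*ΣE≡arcSum (λ _ _ → 1) (λ _ _ → refl) ⟨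
    2 * edges G                     ∎
    where open ≡-Reasoning

deg≡count-punchIn : ∀ {n} (G : Graph (suc n)) u → deg G u ≡ count (adj G u ∘ punchIn u)
deg≡count-punchIn G u =
  trans (deg≡count G u) (sum-removeAt (λ v → ⟦ adj G u v ⟧) (cong ⟦_⟧ (irrefl G u)))

nonuniversal⇒deg≤ : ∀ {D} (G : Graph (suc (suc D))) u → ¬ Universal G u → deg G u ≤ D
nonuniversal⇒deg≤ {D} G u ¬univ with m≤n⇒m<n∨m≡n (count≤n (adj G u ∘ punchIn u))
... | inj₁ others<D+1 = subst (_≤ D) (sym (deg≡count-punchIn G u)) (≤-pred others<D+1)
... | inj₂ others≡D+1 = ⊥-elim (¬univ λ w w≢u →
  subst (λ x → adj G u x ≡ true) (Finₚ.punchIn-punchOut (w≢u ∘ sym))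
    (count≡n⇒true (adj G u ∘ punchIn u) others≡D+1 (punchOut (w≢u ∘ sym))))

-- The upper bound

m+n≤m⊔n+m*n : ∀ m n → m + n ≤ m ⊔ n + m * n
m+n≤m⊔n+m*n zero    n = m≤m+n n 0
m+n≤m⊔n+m*n (suc m) n = +-mono-≤ (m≤m⊔n (suc m) n) (m≤m+n n (m * n))

module Deficiency {V : ℕ} (G : Graph V) (D : ℕ) (deg≤D : ∀ u → deg G u ≤ D) where

  w : Fin V → ℕ
  w u = D ∸ deg G u

  W : ℕ
  W = sum w

  A : ℕ
  A = arcSum G (λ u v → w u ⊔ w v)

  deg+w≡D : ∀ u → deg G u + w u ≡ D
  deg+w≡D u = m+[n∸m]≡n (deg≤D u)

  sum-deg+W≡V*D : sum (deg G) + W ≡ V * D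
  sum-deg+W≡V*D = trans (sym (∑-distrib-+ (deg G) w)) (trans (sum-cong-≗ deg+w≡D) (sum-const V D))

  2*S+A≡D*2e : 2 * S G + A ≡ D * (2 * edges G)
  2*S+A≡D*2e = begin
    2 * S G + A
      ≡⟨ cong (_+ A) (2*ΣE≡arcSum G min-deg (λ u v → ⊓-comm (deg G u) (deg G v))) ⟩
    arcSum G min-deg + A
      ≡⟨ arcSum-+ G min-deg (λ u v → w u ⊔ w v) ⟨
    arcSum G (λ u v → min-deg u v + (w u ⊔ w v))
      ≡⟨ arcSum-cong G (λ u v _ → min+max≡D u v) ⟩
    arcSum G (λ u v → D)
      ≡⟨ arcSum-row G (λ _ → D) ⟩
    sum (λ u → D * deg G u)
      ≡⟨ sum-*ˡ D (deg G) ⟩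
    D * sum (deg G)
      ≡⟨ cong (D *_) (handshake G) ⟩
    D * (2 * edges G) ∎
    where
    open ≡-Reasoning
    min-deg : Fin V → Fin V → ℕ
    min-deg u v = deg G u ⊓ deg G v
    min+max≡D : ∀ u v → min-deg u v + (w u ⊔ w v) ≡ D
    min+max≡D u v = trans (cong (min-deg u v +_) (sym (∸-distribˡ-⊓-⊔ D (deg G u) (deg G v))))
      (m+[n∸m]≡n (≤-trans (m⊓n≤m (deg G u) (deg G v)) (deg≤D u)))

  deficiency-bound : 2 * (W * D) ≤ A + 2 * (W * W)
  deficiency-bound = subst (_≤ A + 2 * (W * W)) (cong (2 *_) P+Q≡W*D)
    (combine {P} {Q} 2P≤A+M (arcSum-product G w) Q≤W*W)
    where
    P Q M : ℕ
    P = sum λ u → w u * deg G u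
    Q = sum λ u → w u * w u
    M = arcSum G (λ u v → w u * w v)

    P+Q≡W*D : P + Q ≡ W * D
    P+Q≡W*D = begin
      P + Q
        ≡⟨ ∑-distrib-+ (λ u → w u * deg G u) (λ u → w u * w u) ⟨
      sum (λ u → w u * deg G u + w u * w u)
        ≡⟨ sum-cong-≗ (λ u → *-distribˡ-+ (w u) (deg G u) (w u)) ⟨
      sum (λ u → w u * (deg G u + w u))
        ≡⟨ sum-cong-≗ (λ u → trans (cong (w u *_) (deg+w≡D u)) (*-comm (w u) D)) ⟩
      sum (λ u → D * w u)
        ≡⟨ sum-*ˡ D w ⟩
      D * W
        ≡⟨ *-comm D W ⟩
      W * D ∎
      where open ≡-Reasoning

    2P≤A+M : 2 * P ≤ A + M
    2P≤A+M = begin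
      2 * P
        ≡⟨ arcSum-endpoints G w ⟨
      arcSum G (λ u v → w u + w v)
        ≤⟨ arcSum-mono-≤ G (λ u v → m+n≤m⊔n+m*n (w u) (w v)) ⟩
      arcSum G (λ u v → w u ⊔ w v + w u * w v)
        ≡⟨ arcSum-+ G (λ u v → w u ⊔ w v) (λ u v → w u * w v) ⟩
      A + M ∎
      where open ≤-Reasoning

    Q≤W*W : Q ≤ W * W
    Q≤W*W = begin
      Q                       ≤⟨ sum-mono-≤ (λ u → *-monoʳ-≤ (w u) (term≤sum w u)) ⟩
      sum (λ u → w u * W)     ≡⟨ sum-cong-≗ (λ u → *-comm (w u) W) ⟩
      sum (λ u → W * w u)     ≡⟨ sum-*ˡ W w ⟩
      W * W                   ∎
      where open ≤-Reasoning

    combine : ∀ {p q a r x} → 2 * p ≤ a + r → r + q ≤ x → q ≤ x → 2 * (p + q) ≤ a + 2 * x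
    combine {p} {q} {a} {r} {x} 2p≤a+r r+q≤x q≤x = begin
      2 * (p + q)         ≡⟨ solve (p ∷ q ∷ []) ⟩
      2 * p + (q + q)     ≤⟨ +-monoˡ-≤ (q + q) 2p≤a+r ⟩
      (a + r) + (q + q)   ≡⟨ solve (a ∷ r ∷ q ∷ []) ⟩
      a + ((r + q) + q)   ≤⟨ +-monoʳ-≤ a (+-mono-≤ r+q≤x q≤x) ⟩
      a + (x + x)         ≡⟨ solve (a ∷ x ∷ []) ⟩
      a + 2 * x           ∎
      where open ≤-Reasoning

2*[1+n]C2≡[1+n]*n : ∀ n → 2 * (suc n C 2) ≡ suc n * n
2*[1+n]C2≡[1+n]*n zero    = refl
2*[1+n]C2≡[1+n]*n (suc n) = begin
  2 * (suc (suc n) C 2)            ≡⟨ cong (2 *_) (nCk+nC[k+1]≡[n+1]C[k+1] (suc n) 1) ⟨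
  2 * (suc n C 1 + suc n C 2)      ≡⟨ cong (λ x → 2 * (x + suc n C 2)) (nC1≡n (suc n)) ⟩
  2 * (suc n + suc n C 2)          ≡⟨ *-distribˡ-+ 2 (suc n) (suc n C 2) ⟩
  2 * suc n + 2 * (suc n C 2)      ≡⟨ cong (2 * suc n +_) (2*[1+n]C2≡[1+n]*n n) ⟩
  2 * suc n + suc n * n            ≡⟨ solve (n ∷ []) ⟩
  suc (suc n) * suc n              ∎
  where open ≡-Reasoning

-- The graph has n + 2 vertices: this n is the n − 1 of the statement.
module _ {n m : ℕ} (G : Graph (suc (suc n))) (deg≤n : ∀ u → deg G u ≤ n)
         (edges≡ : edges G ≡ suc n C 2 + m) where

  open Deficiency G n deg≤n

  sum-deg≡[1+n]*n+2m : sum (deg G) ≡ suc n * n + 2 * m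
  sum-deg≡[1+n]*n+2m = begin
    sum (deg G)                  ≡⟨ handshake G ⟩
    2 * edges G                  ≡⟨ cong (2 *_) edges≡ ⟩
    2 * (suc n C 2 + m)          ≡⟨ *-distribˡ-+ 2 (suc n C 2) m ⟩
    2 * (suc n C 2) + 2 * m      ≡⟨ cong (_+ 2 * m) (2*[1+n]C2≡[1+n]*n n) ⟩
    suc n * n + 2 * m            ∎
    where open ≡-Reasoning

  W+2m≡n : W + 2 * m ≡ n
  W+2m≡n = cancel (trans (cong (_+ W) (sym sum-deg≡[1+n]*n+2m)) sum-deg+W≡V*D)
    where
    cancel : ∀ {x} → (suc n * n + 2 * m) + x ≡ suc (suc n) * n → x + 2 * m ≡ n
    cancel {x} eq = +-cancelˡ-≡ (suc n * n) (x + 2 * m) n (begin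
      suc n * n + (x + 2 * m)    ≡⟨ solve (n ∷ m ∷ x ∷ []) ⟩
      (suc n * n + 2 * m) + x    ≡⟨ eq ⟩
      suc (suc n) * n            ≡⟨ solve (n ∷ []) ⟩
      suc n * n + n              ∎)
      where open ≡-Reasoning

  4mW≤A : 4 * m * W ≤ A
  4mW≤A = +-cancelʳ-≤ (2 * (W * W)) (4 * m * W) A
    (subst (_≤ A + 2 * (W * W)) (sym (expand W+2m≡n)) deficiency-bound)
    where
    expand : ∀ {x} → x + 2 * m ≡ n → 4 * m * x + 2 * (x * x) ≡ 2 * (x * n)
    expand {x} refl = solve (m ∷ x ∷ [])

  W≡n∸2m : W ≡ n ∸ 2 * m
  W≡n∸2m = trans (sym (m+n∸n≡m W (2 * m))) (cong (_∸ 2 * m) W+2m≡n)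

  2*[S+2m[n∸2m]]≡2S+4mW : 2 * (S G + 2 * m * (n ∸ 2 * m)) ≡ 2 * S G + 4 * m * W
  2*[S+2m[n∸2m]]≡2S+4mW = trans (distribute {S G}) (cong (λ k → 2 * S G + 4 * m * k) (sym W≡n∸2m))
    where
    distribute : ∀ {s k} → 2 * (s + 2 * m * k) ≡ 2 * s + 4 * m * k
    distribute {s} {k} = solve (s ∷ m ∷ k ∷ [])

  2*[n*e]≡n*2e : 2 * (n * edges G) ≡ n * (2 * edges G)
  2*[n*e]≡n*2e = commute {edges G}
    where
    commute : ∀ {e} → 2 * (n * e) ≡ n * (2 * e)
    commute {e} = solve (n ∷ e ∷ [])

  S+2m[n∸2m]≤n*e : S G + 2 * m * (n ∸ 2 * m) ≤ n * edges G
  S+2m[n∸2m]≤n*e = *-cancelˡ-≤ 2 (begin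
    2 * (S G + 2 * m * (n ∸ 2 * m))  ≡⟨ 2*[S+2m[n∸2m]]≡2S+4mW ⟩
    2 * S G + 4 * m * W              ≤⟨ +-monoʳ-≤ (2 * S G) 4mW≤A ⟩
    2 * S G + A                      ≡⟨ 2*S+A≡D*2e ⟩
    n * (2 * edges G)                ≡⟨ 2*[n*e]≡n*2e ⟨
    2 * (n * edges G)                ∎)
    where open ≤-Reasoning

  S+2m[n∸2m]≡n*e : A ≡ 4 * m * W → S G + 2 * m * (n ∸ 2 * m) ≡ n * edges G
  S+2m[n∸2m]≡n*e A≡4mW = *-cancelˡ-≡ (S G + 2 * m * (n ∸ 2 * m)) (n * edges G) 2 (begin
    2 * (S G + 2 * m * (n ∸ 2 * m))  ≡⟨ 2*[S+2m[n∸2m]]≡2S+4mW ⟩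
    2 * S G + 4 * m * W              ≡⟨ cong (2 * S G +_) A≡4mW ⟨
    2 * S G + A                      ≡⟨ 2*S+A≡D*2e ⟩
    n * (2 * edges G)                ≡⟨ 2*[n*e]≡n*2e ⟨
    2 * (n * edges G)                ∎)
    where open ≡-Reasoning

-- The extremal graph

module Construction {n m : ℕ} (1≤m : 1 ≤ m) (2m≤n : 2 * m ≤ n) where

  2m≡m+m : 2 * m ≡ m + m
  2m≡m+m = cong (m +_) (+-identityʳ m)

  i+m≢i : ∀ i → i + m ≢ i
  i+m≢i i = ≢-sym (<⇒≢ (m<m+n i 1≤m))

  i∸m<m : ∀ {i} → i < 2 * m → ¬ i < m → i ∸ m < m
  i∸m<m {i} i<2m i≮m = +-cancelʳ-< m (i ∸ m) m
    (subst (_< m + m) (sym (m∸n+n≡m (≮⇒≥ i≮m))) (subst (i <_) 2m≡m+m i<2m))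

  partner : ℕ → ℕ
  partner i = if i <ᵇ m then i + m else i ∸ m

  partner≢ : ∀ i → partner i ≢ i
  partner≢ i with i <ᵇ m | <ᵇ-reflects-< i m
  ... | true  | ofʸ _   = i+m≢i i
  ... | false | ofⁿ i≮m = λ eq → i+m≢i i (trans (cong (_+ m) (sym eq)) (m∸n+n≡m (≮⇒≥ i≮m)))

  partner-< : ∀ {i} → i < 2 * m → partner i < 2 * m
  partner-< {i} i<2m with i <ᵇ m | <ᵇ-reflects-< i m
  ... | true  | ofʸ i<m = subst (i + m <_) (sym 2m≡m+m) (+-monoˡ-< m i<m)
  ... | false | ofⁿ i≮m = <-≤-trans (i∸m<m i<2m i≮m) (m≤m+n m _)

  partner-involutive : ∀ {i} → i < 2 * m → partner (partner i) ≡ i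
  partner-involutive {i} i<2m with i <ᵇ m | <ᵇ-reflects-< i m
  ... | true  | ofʸ _ with i + m <ᵇ m | <ᵇ-reflects-< (i + m) m
  ...   | true  | ofʸ i+m<m = ⊥-elim (<⇒≱ i+m<m (m≤n+m m i))
  ...   | false | ofⁿ _     = m+n∸n≡m i m
  partner-involutive {i} i<2m | false | ofⁿ i≮m with i ∸ m <ᵇ m | <ᵇ-reflects-< (i ∸ m) m
  ...   | true  | ofʸ _     = m∸n+n≡m (≮⇒≥ i≮m)
  ...   | false | ofⁿ i∸m≮m = ⊥-elim (i∸m≮m (i∸m<m i<2m i≮m))

  matched : ℕ → ℕ → Bool
  matched i j = (i <ᵇ 2 * m) ∧ (partner i ≡ᵇ j)

  matched⇒ : ∀ {i j} → matched i j ≡ true → i < 2 * m × partner i ≡ j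
  matched⇒ {i} {j} eq with i <ᵇ 2 * m | <ᵇ-reflects-< i (2 * m) | partner i ≡ᵇ j | proof (partner i ≟ j)
  ... | true  | ofʸ i<2m | true  | ofʸ pi≡j = i<2m , pi≡j
  ... | true  | _        | false | _        with () ← eq
  ... | false | _        | _     | _        with () ← eq

  matched-partner : ∀ {i} → i < 2 * m → matched i (partner i) ≡ true
  matched-partner {i} i<2m with i <ᵇ 2 * m | <ᵇ-reflects-< i (2 * m)
  ... | true  | _         = ≡ᵇ-refl (partner i)
  ... | false | ofⁿ i≮2m = ⊥-elim (i≮2m i<2m)

  matched-flip : ∀ {i j} → matched i j ≡ true → matched j i ≡ true
  matched-flip {i} eq with matched⇒ eq
  ... | i<2m , refl = subst (λ k → matched (partner i) k ≡ true) (partner-involutive i<2m)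
                        (matched-partner (partner-< i<2m))

  matched-sym : ∀ i j → matched i j ≡ matched j i
  matched-sym i j = ⇔→≡ {z = true} (mk⇔ matched-flip matched-flip)

  matched-row : ∀ a → count (λ (j : Fin (suc n)) → matched a (toℕ j)) ≡ ⟦ a <ᵇ 2 * m ⟧
  matched-row a with a <ᵇ 2 * m | <ᵇ-reflects-< a (2 * m)
  ... | true  | ofʸ a<2m = count-≡ᵇ (<-≤-trans (partner-< a<2m) (m≤n⇒m≤1+n 2m≤n))
  ... | false | _        = sum-replicate-zero (suc n)

  -- Vertex zero is joined to the first 2m other vertices; those n + 1 vertices form
  -- a clique without the perfect matching {i, partner i} of the first 2m of them.
  adj₀ : Fin (suc (suc n)) → Fin (suc (suc n)) → Bool
  adj₀ zero    zero    = false
  adj₀ zero    (suc j) = toℕ j <ᵇ 2 * m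
  adj₀ (suc i) zero    = toℕ i <ᵇ 2 * m
  adj₀ (suc i) (suc j) = not ((toℕ i ≡ᵇ toℕ j) ∨ matched (toℕ i) (toℕ j))

  adj₀-sym : ∀ u v → adj₀ u v ≡ adj₀ v u
  adj₀-sym zero    zero    = refl
  adj₀-sym zero    (suc j) = refl
  adj₀-sym (suc i) zero    = refl
  adj₀-sym (suc i) (suc j) =
    cong₂ (λ x y → not (x ∨ y)) (≡ᵇ-sym (toℕ i) (toℕ j)) (matched-sym (toℕ i) (toℕ j))

  adj₀-irrefl : ∀ u → adj₀ u u ≡ false
  adj₀-irrefl zero    = refl
  adj₀-irrefl (suc i) = cong (λ x → not (x ∨ matched (toℕ i) (toℕ i))) (≡ᵇ-refl (toℕ i))

  G₀ : Graph (suc (suc n))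
  G₀ = record { adj = adj₀ ; sym = adj₀-sym ; irrefl = adj₀-irrefl }

  deg₀-hub : deg G₀ zero ≡ 2 * m
  deg₀-hub = trans (deg≡count G₀ zero) (count-<ᵇ (m≤n⇒m≤1+n 2m≤n))

  deg₀-clique : ∀ i → deg G₀ (suc i) ≡ n
  deg₀-clique i = trans (deg≡count G₀ (suc i))
    (cancel (trans (cong (count (not ∘ excluded) +_) (sym excluded-count)) (count-not excluded)))
    where
    a : ℕ
    a = toℕ i
    excluded : Fin (suc n) → Bool
    excluded j = (a ≡ᵇ toℕ j) ∨ matched a (toℕ j)
    disjoint : ∀ j → (a ≡ᵇ toℕ j) ≡ true → matched a (toℕ j) ≢ true
    disjoint j a≡j pa≡j = partner≢ a (trans (proj₂ (matched⇒ pa≡j))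
      (sym (≡ᵇ⇒≡ a (toℕ j) (Equivalence.from T-≡ a≡j))))
    excluded-count : count excluded ≡ 1 + ⟦ a <ᵇ 2 * m ⟧
    excluded-count = trans (count-∨ {suc n} (λ j → a ≡ᵇ toℕ j) (λ j → matched a (toℕ j)) disjoint)
      (cong₂ _+_ (count-≡ᵇ {suc n} (Finₚ.toℕ<n i)) (matched-row a))
    cancel : ∀ {b x} → x + (1 + b) ≡ suc n → b + x ≡ n
    cancel {b} {x} eq = suc-injective (begin
      suc (b + x)     ≡⟨ solve (b ∷ x ∷ []) ⟩
      x + (1 + b)     ≡⟨ eq ⟩
      suc n           ∎)
      where open ≡-Reasoning

  deg₀≤n : ∀ u → deg G₀ u ≤ n
  deg₀≤n zero    = ≤-trans (≤-reflexive deg₀-hub) 2m≤n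
  deg₀≤n (suc i) = ≤-reflexive (deg₀-clique i)

  edges₀ : edges G₀ ≡ suc n C 2 + m
  edges₀ = *-cancelˡ-≡ (edges G₀) (suc n C 2 + m) 2 (begin
    2 * edges G₀                      ≡⟨ handshake G₀ ⟨
    deg G₀ zero + sum (deg G₀ ∘ suc)  ≡⟨ cong₂ _+_ deg₀-hub
                                           (trans (sum-cong-≗ deg₀-clique) (sum-const (suc n) n)) ⟩
    2 * m + suc n * n                 ≡⟨ cong (2 * m +_) (2*[1+n]C2≡[1+n]*n n) ⟨
    2 * m + 2 * (suc n C 2)           ≡⟨ +-comm (2 * m) _ ⟩
    2 * (suc n C 2) + 2 * m           ≡⟨ *-distribˡ-+ 2 (suc n C 2) m ⟨
    2 * (suc n C 2 + m)               ∎)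
    where open ≡-Reasoning

  nonuniversal₀ : ∀ u → ¬ Universal G₀ u
  nonuniversal₀ zero univ = <-irrefl refl (<ᵇ⇒< (2 * m) (2 * m) (Equivalence.from T-≡ 2m<ᵇ2m))
    where
    2m<1+n : 2 * m < suc n
    2m<1+n = s≤s 2m≤n
    2m<ᵇ2m : (2 * m <ᵇ 2 * m) ≡ true
    2m<ᵇ2m = subst (λ k → (k <ᵇ 2 * m) ≡ true) (Finₚ.toℕ-fromℕ< 2m<1+n)
      (univ (suc (Fin.fromℕ< 2m<1+n)) λ ())
  nonuniversal₀ (suc i) univ with toℕ i <ᵇ 2 * m | <ᵇ-reflects-< (toℕ i) (2 * m)
  ... | false | ofⁿ i≮2m = i≮2m (<ᵇ⇒< (toℕ i) (2 * m) (Equivalence.from T-≡ (univ zero λ ())))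
  ... | true  | ofʸ i<2m = false≢true (trans (sym non-adjacent) (univ (suc j) j≢i))
    where
    p<1+n : partner (toℕ i) < suc n
    p<1+n = <-≤-trans (partner-< i<2m) (m≤n⇒m≤1+n 2m≤n)
    j : Fin (suc n)
    j = Fin.fromℕ< p<1+n
    toℕ-j : toℕ j ≡ partner (toℕ i)
    toℕ-j = Finₚ.toℕ-fromℕ< p<1+n
    j≢i : suc j ≢ suc i
    j≢i eq = partner≢ (toℕ i) (trans (sym toℕ-j) (cong toℕ (Finₚ.suc-injective eq)))
    false≢true : false ≢ true
    false≢true ()
    non-adjacent : adj₀ (suc i) (suc j) ≡ false
    non-adjacent = cong not (trans (cong ((toℕ i ≡ᵇ toℕ j) ∨_)
        (trans (cong (matched (toℕ i)) toℕ-j) (matched-partner i<2m)))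
      (∨-zeroʳ (toℕ i ≡ᵇ toℕ j)))

  open Deficiency G₀ n deg₀≤n

  w-hub : w zero ≡ n ∸ 2 * m
  w-hub = cong (n ∸_) deg₀-hub

  w-clique : ∀ i → w (suc i) ≡ 0
  w-clique i = trans (cong (n ∸_) (deg₀-clique i)) (n∸n≡0 n)

  A₀≡4mW : A ≡ 4 * m * W
  A₀≡4mW = begin
    A                                          ≡⟨ arcSum-cong G₀ max≡sum ⟩
    arcSum G₀ (λ u v → w u + w v)              ≡⟨ arcSum-endpoints G₀ w ⟩
    2 * (w zero * deg G₀ zero + sum (λ i → w (suc i) * deg G₀ (suc i)))
      ≡⟨ cong (λ x → 2 * (w zero * deg G₀ zero + x))
           (trans (sum-cong-≗ λ i → cong (_* deg G₀ (suc i)) (w-clique i)) (sum-replicate-zero (suc n))) ⟩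
    2 * (w zero * deg G₀ zero + 0)             ≡⟨ cong₂ (λ x y → 2 * (x * y + 0)) w-hub deg₀-hub ⟩
    2 * ((n ∸ 2 * m) * (2 * m) + 0)            ≡⟨ regroup ⟩
    4 * m * (n ∸ 2 * m)                        ≡⟨ cong (4 * m *_) (W≡n∸2m G₀ deg₀≤n edges₀) ⟨
    4 * m * W                                  ∎
    where
    open ≡-Reasoning
    max≡sum : ∀ u v → adj₀ u v ≡ true → w u ⊔ w v ≡ w u + w v
    max≡sum zero    (suc j) _ rewrite w-clique j = trans (⊔-identityʳ (w zero)) (sym (+-identityʳ (w zero)))
    max≡sum (suc i) v       _ rewrite w-clique i = refl
    regroup : ∀ {k} → 2 * (k * (2 * m) + 0) ≡ 4 * m * k
    regroup {k} = solve (k ∷ m ∷ [])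

-- Opened only here: ℤ's prefix +_ makes the ℕ sections (x +_) above ambiguous.
open import Data.Integer using (ℤ; +_; _-_)
import Data.Integer as ℤ
import Data.Integer.Properties as ℤ
open import Data.Integer.Tactic.RingSolver renaming (solve to solve-ℤ)

extremal-value-ℤ : ∀ (σ μ κ γ τ φ : ℤ) → τ ≡ + 2 ℤ.* μ → φ ≡ + 4 ℤ.* μ →
  σ ℤ.+ τ ℤ.* κ ≡ (κ ℤ.+ τ) ℤ.* (γ ℤ.+ μ) →
  σ ≡ (κ ℤ.+ τ) ℤ.* γ ℤ.+ μ ℤ.* (φ - (+ 1 ℤ.+ (κ ℤ.+ τ)) ℤ.+ + 1)
extremal-value-ℤ σ μ κ γ _ _ refl refl h = begin
  σ                                             ≡⟨ solve-ℤ (σ ∷ μ ∷ κ ∷ []) ⟩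
  σ ℤ.+ + 2 ℤ.* μ ℤ.* κ - + 2 ℤ.* μ ℤ.* κ       ≡⟨ cong (_- + 2 ℤ.* μ ℤ.* κ) h ⟩
  (κ ℤ.+ + 2 ℤ.* μ) ℤ.* (γ ℤ.+ μ) - + 2 ℤ.* μ ℤ.* κ ≡⟨ solve-ℤ (μ ∷ κ ∷ γ ∷ []) ⟩
  (κ ℤ.+ + 2 ℤ.* μ) ℤ.* γ ℤ.+ μ ℤ.* (+ 4 ℤ.* μ - (+ 1 ℤ.+ (κ ℤ.+ + 2 ℤ.* μ)) ℤ.+ + 1) ∎
  where open ≡-Reasoning

extremal-value : ∀ {s m n C} → 2 * m ≤ n → s + 2 * m * (n ∸ 2 * m) ≡ n * (C + m) →
  + s ≡ + n ℤ.* + C ℤ.+ + m ℤ.* (+ (4 * m) - + suc n ℤ.+ + 1)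
extremal-value {s} {m} {n} {C} 2m≤n eq with n ∸ 2 * m | m∸n+n≡m 2m≤n
... | k | refl = extremal-value-ℤ (+ s) (+ m) (+ k) (+ C) (+ (2 * m)) (+ (4 * m))
  (ℤ.pos-* 2 m) (ℤ.pos-* 4 m)
  (trans (cong (λ x → + s ℤ.+ x) (sym (ℤ.pos-* (2 * m) k)))
    (trans (cong +_ eq) (ℤ.pos-* (k + 2 * m) (C + m))))

lemma8 : (n m N : ℕ) → 1 ≤ n → 1 ≤ m → 2 * m ≤ n ∸ 1 → N ≡ n C 2 + m →
    Σ ℕ (λ c → IsMaxS N (suc n) c ×
      (+ c ≡ (+ (n ∸ 1)) ℤ.* (+ (n C 2)) ℤ.+ (+ m) ℤ.* ((+ (4 * m)) - (+ n) ℤ.+ (+ 1))))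
lemma8 zero    _ _ ()  _   _    _
lemma8 (suc n) m _ _   1≤m 2m≤n refl =
  S G₀ , ((G₀ , edges₀ , nonuniversal₀ , refl) , maximal) , extremal-value 2m≤n S₀-extremal
  where
  open Construction 1≤m 2m≤n
  S₀-extremal : S G₀ + 2 * m * (n ∸ 2 * m) ≡ n * (suc n C 2 + m)
  S₀-extremal = trans (S+2m[n∸2m]≡n*e G₀ deg₀≤n edges₀ A₀≡4mW) (cong (n *_) edges₀)
  maximal : ∀ G → edges G ≡ suc n C 2 + m → (∀ v → ¬ Universal G v) → S G ≤ S G₀
  maximal G edges≡ ¬univ = +-cancelʳ-≤ (2 * m * (n ∸ 2 * m)) (S G) (S G₀) (begin
    S G + 2 * m * (n ∸ 2 * m)    ≤⟨ S+2m[n∸2m]≤n*e G (λ u → nonuniversal⇒deg≤ G u (¬univ u)) edges≡ ⟩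
    n * edges G                  ≡⟨ cong (n *_) edges≡ ⟩
    n * (suc n C 2 + m)          ≡⟨ S₀-extremal ⟨
    S G₀ + 2 * m * (n ∸ 2 * m)   ∎)
    where open ≤-Reasoning
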